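{- If the inequality $2^{H^{G^F}-H}>G^{FH^G}$ holds for all natural numbers $F,G,H\ge2$, then $I^{H^{G^F}\Gamma}>(G^F)^{H^G\Gamma}I^{H\Gamma}$ holds for all natural numbers $F,G,H,I\ge 2$ and $\Gamma\ge1$. -}

module Defs where

-- Write A = H^(G^F), B = G^F, C = H^G.  The proof has three steps.
--  * Since B ≥ 1 and H ≥ 2 we have H ≤ A  (`m≤m^n`).
--  * Replacing the base 2 by I ≥ 2 and multiplying by I^H turns the
--    hypothesis B^C = G^(F·C) < 2^(A ∸ H) into B^C · I^H < I^A
--    (`absorb-power`, valid for any exponents H ≤ A and any x).
--  * Raising a strict inequality x^c · y^h < y^a to a positive power g
--    multiplies every exponent by g (`scale-exponents`); with g = Γ this
--    is exactly the claim.
module Submission where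

open import Defs
open import Data.Nat using (ℕ; _+_; _*_; _∸_; _^_; _≤_; _<_; _>_)
open import Data.Nat.Base using (zero; suc; s≤s; z≤n; NonZero; >-nonZero)
open import Data.Nat.Properties
open import Data.Nat.Solver using (module +-*-Solver)
open import Relation.Binary.PropositionalEquality

^-distribʳ-* : ∀ x y n → (x * y) ^ n ≡ x ^ n * y ^ n
^-distribʳ-* x y zero    = refl
^-distribʳ-* x y (suc n) = begin
  x * y * (x * y) ^ n      ≡⟨ cong (x * y *_) (^-distribʳ-* x y n) ⟩
  x * y * (x ^ n * y ^ n)  ≡⟨ swap-middle x y (x ^ n) (y ^ n) ⟩
  x * x ^ n * (y * y ^ n)  ∎
  where
  open ≡-Reasoning
  open +-*-Solver
  swap-middle : ∀ a b c d → a * b * (c * d) ≡ a * c * (b * d)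
  swap-middle = solve 4 (λ a b c d → a :* b :* (c :* d) := a :* c :* (b :* d)) refl

m≤m^n : ∀ m n → 1 ≤ m → 1 ≤ n → m ≤ m ^ n
m≤m^n m (suc n) 1≤m _ = begin
  m          ≡⟨ sym (*-identityʳ m) ⟩
  m * 1      ≤⟨ *-monoʳ-≤ m (^-monoʳ-≤ m {{>-nonZero 1≤m}} (z≤n {n})) ⟩
  m * m ^ n  ∎
  where open ≤-Reasoning

-- If x < 2^(a ∸ h) with h ≤ a and y ≥ 2, then x · y^h < y^a: the base 2 may
-- be enlarged to y, and the missing factor y^h completes the exponent to a.
absorb-power : ∀ x y h a → 2 ≤ y → h ≤ a → x < 2 ^ (a ∸ h) → x * y ^ h < y ^ a
absorb-power x y h a 2≤y h≤a x<2^[a∸h] = begin-strict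
  x * y ^ h            <⟨ *-monoˡ-< (y ^ h) {{y^h≢0}} x<2^[a∸h] ⟩
  2 ^ (a ∸ h) * y ^ h  ≤⟨ *-monoˡ-≤ (y ^ h) (^-monoˡ-≤ (a ∸ h) 2≤y) ⟩
  y ^ (a ∸ h) * y ^ h  ≡⟨ sym (^-distribˡ-+-* y (a ∸ h) h) ⟩
  y ^ (a ∸ h + h)      ≡⟨ cong (y ^_) (m∸n+n≡m h≤a) ⟩
  y ^ a                ∎
  where
  open ≤-Reasoning
  y^h≢0 : NonZero (y ^ h)
  y^h≢0 = m^n≢0 y h {{>-nonZero (≤-trans (s≤s z≤n) 2≤y)}}

scale-exponents : ∀ x c y h a g → 1 ≤ g →
  x ^ c * y ^ h < y ^ a → x ^ (c * g) * y ^ (h * g) < y ^ (a * g)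
scale-exponents x c y h a g@(suc _) _ lt = subst₂ _<_
  (trans (^-distribʳ-* (x ^ c) (y ^ h) g)
         (cong₂ _*_ (^-*-assoc x c g) (^-*-assoc y h g)))
  (^-*-assoc y a g)
  (^-monoˡ-< g lt)

lemma9 : ((F G H : ℕ) → 2 ≤ F → 2 ≤ G → 2 ≤ H →
    2 ^ (H ^ (G ^ F) ∸ H) > G ^ (F * H ^ G)) →
    (F G H I Γ : ℕ) → 2 ≤ F → 2 ≤ G → 2 ≤ H → 2 ≤ I → 1 ≤ Γ →
    I ^ (H ^ (G ^ F) * Γ) > (G ^ F) ^ (H ^ G * Γ) * I ^ (H * Γ)
lemma9 hyp F G H I Γ 2≤F 2≤G 2≤H 2≤I 1≤Γ =
  scale-exponents (G ^ F) (H ^ G) I H (H ^ (G ^ F)) Γ 1≤Γ base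
  where
  H≤A : H ≤ H ^ (G ^ F)
  H≤A = m≤m^n H (G ^ F) (≤-trans (n≤1+n 1) 2≤H)
          (m^n>0 G {{>-nonZero (≤-trans (n≤1+n 1) 2≤G)}} F)
  hyp′ : (G ^ F) ^ (H ^ G) < 2 ^ (H ^ (G ^ F) ∸ H)
  hyp′ = subst (_< 2 ^ (H ^ (G ^ F) ∸ H)) (sym (^-*-assoc G F (H ^ G)))
           (hyp F G H 2≤F 2≤G 2≤H)
  base : (G ^ F) ^ (H ^ G) * I ^ H < I ^ (H ^ (G ^ F))
  base = absorb-power ((G ^ F) ^ (H ^ G)) I H (H ^ (G ^ F)) 2≤I H≤A hyp′
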